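{- For integers $m\ge 3$ and $r\ge 1$, \[\mathrm{pt}_+(L_{m,r})=\left\lceil \frac{|V(L_{m,r})|-\mathrm{Z}_+(L_{m,r})}{2}\right\rceil.\]
   Context: The lollipop graph $L_{m,r}$ ($m\ge3$) is obtained from a complete graph $K_m$ and a disjoint path $P_r$ on $r$ vertices by adding one edge between a vertex of $K_m$ and an endpoint of $P_r$; it has order $m+r$. PSD color change rule: let $B$ be the current set of blue vertices and let $W_1,\dots,W_s$ be the vertex sets of the components of $G-B$; if $u\in B$, $w\in W_i$, and $w$ is the only white neighbor of $u$ in $G[W_i\cup B]$, then $w$ may be colored blue. $B$ is a PSD forcing set if repeated application from exactly $B$ blue colors all vertices; $\mathrm{Z}_+(G)$ is the minimum size of a PSD forcing set. $B^{[0]}=B$, $B^{[i+1]}$ is $B^{[i]}$ together with all vertices that can be PSD forced when exactly $B^{[i]}$ is blue, $\mathrm{pt}_+(G;B)$ is the least $t$ with $B^{[t]}=V(G)$, and $\mathrm{pt}_+(G)=\min\{\mathrm{pt}_+(G;B):|B|=\mathrm{Z}_+(G)\}$. -}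

module Defs where

open import Data.Nat using (ℕ; zero; suc; _+_; _<_; _≤_; _≥_)
open import Data.Fin using (Fin; toℕ)
open import Data.Fin.Subset using (Subset; _∈_; ∣_∣)
open import Data.Product using (Σ; ∃; _×_; _,_)
open import Data.Sum using (_⊎_)
open import Relation.Nullary using (¬_)
open import Relation.Binary.PropositionalEquality using (_≡_)

record Graph (n : ℕ) : Set₁ where
  field
    Adj     : Fin n → Fin n → Set
    irrefl  : ∀ {x} → ¬ Adj x x
    sym     : ∀ {x y} → Adj x y → Adj y x

open Graph public

-- Lollipop L_{m,r} on vertices 0,…,m+r-1: vertices 0..m-1 form K_m,
-- vertices m..m+r-1 form the path P_r (consecutive vertices adjacent),
-- and the extra edge joins m-1 (in K_m) to m (endpoint of P_r).
data LolAdj (m : ℕ) (i j : ℕ) : Set where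
  clique  : i < m → j < m → ¬ i ≡ j → LolAdj m i j
  pathR   : m ≤ j → suc i ≡ j → LolAdj m i j
  pathL   : m ≤ i → suc j ≡ i → LolAdj m i j

lollipop : (m r : ℕ) → Graph (m + r)
lollipop m r = record { Adj = λ x y → LolAdj m (toℕ x) (toℕ y) ; irrefl = irr ; sym = sy }
  where
  open import Data.Nat.Properties using (<-irrefl; n<1+n)
  open import Relation.Binary.PropositionalEquality using (refl) renaming (sym to ≡sym)
  irr : ∀ {x} → ¬ LolAdj m (toℕ x) (toℕ x)
  irr (clique _ _ ne) = ne refl
  irr {x} (pathR _ e) = <-irrefl (≡sym e) (n<1+n (toℕ x))
  irr {x} (pathL _ e) = <-irrefl (≡sym e) (n<1+n (toℕ x))
  sy : ∀ {x y} → LolAdj m (toℕ x) (toℕ y) → LolAdj m (toℕ y) (toℕ x)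
  sy (clique a b ne) = clique b a (λ e → ne (≡sym e))
  sy (pathR a e) = pathL a e
  sy (pathL a e) = pathR a e

module _ {n : ℕ} (G : Graph n) where

  data WhiteConn (B : Fin n → Set) : Fin n → Fin n → Set where
    here : ∀ {x} → ¬ B x → WhiteConn B x x
    step : ∀ {x y z} → ¬ B x → Adj G x y → WhiteConn B y z → WhiteConn B x z

  -- PSD color change rule: blue u forces white w if w is the only white
  -- neighbour of u in G[W ∪ B], W the component of G - B containing w.
  PSDForces : (B : Fin n → Set) → Fin n → Fin n → Set
  PSDForces B u w =
    B u × ¬ B w × Adj G u w ×
    (∀ w' → WhiteConn B w w' → Adj G u w' → w' ≡ w)

  Blue : Subset n → ℕ → Fin n → Set
  Blue B zero v = v ∈ B
  Blue B (suc t) v = Blue B t v ⊎ ∃ λ u → PSDForces (Blue B t) u v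

  AllBlueAt : Subset n → ℕ → Set
  AllBlueAt B t = ∀ v → Blue B t v

  IsPSDForcingSet : Subset n → Set
  IsPSDForcingSet B = ∃ λ t → AllBlueAt B t

  IsZplus : ℕ → Set
  IsZplus z =
    (Σ (Subset n) λ B → IsPSDForcingSet B × ∣ B ∣ ≡ z) ×
    (∀ B → IsPSDForcingSet B → z ≤ ∣ B ∣)

  IsPtplusOf : Subset n → ℕ → Set
  IsPtplusOf B t = AllBlueAt B t × (∀ s → AllBlueAt B s → t ≤ s)

  IsPtplus : ℕ → ℕ → Set
  IsPtplus z p =
    (Σ (Subset n) λ B → ∣ B ∣ ≡ z × IsPtplusOf B p) ×
    (∀ B t → ∣ B ∣ ≡ z → IsPtplusOf B t → p ≤ t)

{-# OPTIONS --safe #-}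
-- Let a = m - 1 be the clique vertex carrying the path, so that a, a + 1, ..., a + r is a path,
-- and call the other clique vertices the core.  A set of fewer than a vertices either leaves two
-- core vertices white, and these are closed twins, never forced; or it lies in the core and
-- misses a core vertex x, and then x and a shield each other forever.  Hence Z+ = a.  A set of
-- size a is either the core, or it leaves one core vertex x white and has one blue vertex v on
-- the path.  Collapsing the core to a point, blue spreads at most one step per round, from the
-- core in the first case and from v in the second (x and a again shield each other until one is
-- reached); either way reaching both x and a + r takes at least (r + 1) / 2 rounds.  Leaving 0
-- and a white and putting v in the middle of the path attains this: blue spreads one step per
-- round in both directions along the path, and 0 is forced as soon as a is blue.
module Submission where

open import Defs hiding (sym)
open import Data.Nat
open import Data.Nat.Properties
open import Data.Bool using (Bool; true; false; _∨_; if_then_else_)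
open import Data.Bool.Properties using (T-≡; ∨-zeroʳ)
open import Data.Product using (Σ; ∃; _×_; _,_; proj₁; proj₂)
open import Data.Sum using (_⊎_; inj₁; inj₂; [_,_]; map₁; map₂)
open import Data.Empty using (⊥-elim)
open import Function using (_∘_; module Equivalence)
open import Relation.Nullary using (¬_; yes; no)
open import Relation.Binary.PropositionalEquality
  using (_≡_; _≢_; refl; sym; trans; cong; cong₂; subst; module ≡-Reasoning)
open import Data.Vec using ([]; _∷_; lookup; tabulate)
open import Data.Vec.Properties using ([]=⇒lookup; lookup⇒[]=; lookup∘tabulate)
open import Data.Fin using (Fin; toℕ; fromℕ<)
open import Data.Fin.Properties using (toℕ-injective; toℕ-fromℕ<; toℕ<n)
open import Data.Fin.Subset using (Subset; _∈_; ∣_∣)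

count : (ℕ → Bool) → ℕ → ℕ
count g zero = 0
count g (suc l) = if g 0 then suc (count (g ∘ suc) l) else count (g ∘ suc) l

count-cong : ∀ {g h} l → (∀ i → i < l → g i ≡ h i) → count g l ≡ count h l
count-cong zero eq = refl
count-cong {g} {h} (suc l) eq rewrite eq 0 z<s =
  cong (λ c → if h 0 then suc c else c) (count-cong l (λ i i<l → eq (suc i) (s<s i<l)))

count-+ : ∀ g l₁ l₂ → count g (l₁ + l₂) ≡ count g l₁ + count (λ i → g (l₁ + i)) l₂
count-+ g zero l₂ = refl
count-+ g (suc l₁) l₂ with g 0
... | true = cong suc (count-+ (g ∘ suc) l₁ l₂)
... | false = count-+ (g ∘ suc) l₁ l₂

count-all : ∀ {g} l → (∀ i → i < l → g i ≡ true) → count g l ≡ l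
count-all zero _ = refl
count-all {g} (suc l) all rewrite all 0 z<s = cong suc (count-all l (λ i i<l → all (suc i) (s<s i<l)))

count-≡ᵇ : ∀ {k} l → k < l → count (_≡ᵇ k) l ≡ 1
count-≡ᵇ {zero} (suc l) _ = cong suc (count-all-false l)
  where
  count-all-false : ∀ l → count (λ i → suc i ≡ᵇ 0) l ≡ 0
  count-all-false zero = refl
  count-all-false (suc l) = count-all-false l
count-≡ᵇ {suc k} (suc l) k<l = count-≡ᵇ l (s<s⁻¹ k<l)

count<⇒false : ∀ g l → count g l < l → ∃ λ i → i < l × g i ≡ false
count<⇒false g (suc l) c<l with g 0 in g0
... | false = 0 , z<s , g0
... | true with count<⇒false (g ∘ suc) l (s<s⁻¹ c<l)
...   | i , i<l , gi = suc i , s<s i<l , gi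

count+2≤⇒two-false : ∀ g l → 2 + count g l ≤ l → Σ ℕ λ i → Σ ℕ λ j →
  i < l × j < l × i ≢ j × g i ≡ false × g j ≡ false
count+2≤⇒two-false g (suc l) c<l with g 0 in g0
... | false with count<⇒false (g ∘ suc) l (s<s⁻¹ c<l)
...   | j , j<l , gj = 0 , suc j , z<s , s<s j<l , (λ ()) , g0 , gj
count+2≤⇒two-false g (suc l) c<l | true with count+2≤⇒two-false (g ∘ suc) l (s<s⁻¹ c<l)
...   | i , j , i<l , j<l , i≢j , gi , gj =
  suc i , suc j , s<s i<l , s<s j<l , i≢j ∘ suc-injective , gi , gj

count-pos⇒true : ∀ g l → 1 ≤ count g l → ∃ λ i → i < l × g i ≡ true
count-pos⇒true g (suc l) c>0 with g 0 in g0
... | true = 0 , z<s , g0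
... | false with count-pos⇒true (g ∘ suc) l c>0
...   | i , i<l , gi = suc i , s<s i<l , gi

true⇒count-pos : ∀ g l {i} → i < l → g i ≡ true → 1 ≤ count g l
true⇒count-pos g (suc l) {zero} _ gi rewrite gi = s≤s z≤n
true⇒count-pos g (suc l) {suc i} i<l gi with g 0
... | true = s≤s z≤n
... | false = true⇒count-pos (g ∘ suc) l (s<s⁻¹ i<l) gi

two-true⇒2≤count : ∀ g l {i j} → i < l → j < l → i ≢ j → g i ≡ true → g j ≡ true → 2 ≤ count g l
two-true⇒2≤count g (suc l) {zero} {zero} _ _ i≢j _ _ = ⊥-elim (i≢j refl)
two-true⇒2≤count g (suc l) {zero} {suc j} _ j<l _ gi gj rewrite gi =
  s≤s (true⇒count-pos (g ∘ suc) l (s<s⁻¹ j<l) gj)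
two-true⇒2≤count g (suc l) {suc i} {zero} i<l _ _ gi gj rewrite gj =
  s≤s (true⇒count-pos (g ∘ suc) l (s<s⁻¹ i<l) gi)
two-true⇒2≤count g (suc l) {suc i} {suc j} i<l j<l i≢j gi gj with g 0
... | true = s≤s (true⇒count-pos (g ∘ suc) l (s<s⁻¹ i<l) gi)
... | false = two-true⇒2≤count (g ∘ suc) l (s<s⁻¹ i<l) (s<s⁻¹ j<l) (i≢j ∘ cong suc) gi gj

-- Indices ≥ n are not members.
member : ∀ {n} → Subset n → ℕ → Bool
member [] _ = false
member (b ∷ _) zero = b
member (_ ∷ B) (suc i) = member B i

∣∣≡count-member : ∀ {n} (B : Subset n) → ∣ B ∣ ≡ count (member B) n
∣∣≡count-member [] = refl
∣∣≡count-member (true ∷ B) = cong suc (∣∣≡count-member B)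
∣∣≡count-member (false ∷ B) = ∣∣≡count-member B

member-toℕ : ∀ {n} (B : Subset n) v → member B (toℕ v) ≡ lookup B v
member-toℕ (_ ∷ _) Fin.zero = refl
member-toℕ (_ ∷ B) (Fin.suc v) = member-toℕ B v

∈⇒member : ∀ {n} (B : Subset n) {v} → v ∈ B → member B (toℕ v) ≡ true
∈⇒member B {v} v∈B = trans (member-toℕ B v) ([]=⇒lookup v∈B)

member⇒∈ : ∀ {n} (B : Subset n) {v} → member B (toℕ v) ≡ true → v ∈ B
member⇒∈ B {v} eq = lookup⇒[]= v B (trans (sym (member-toℕ B v)) eq)

member-tabulate : ∀ {n} (f : ℕ → Bool) {i} → i < n → member (tabulate {n = n} (f ∘ toℕ)) i ≡ f i
member-tabulate {n} f {i} i<n = begin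
  member B i                    ≡⟨ cong (member B) (sym (toℕ-fromℕ< i<n)) ⟩
  member B (toℕ (fromℕ< i<n))   ≡⟨ member-toℕ B (fromℕ< i<n) ⟩
  lookup B (fromℕ< i<n)         ≡⟨ lookup∘tabulate (f ∘ toℕ) (fromℕ< i<n) ⟩
  f (toℕ (fromℕ< i<n))          ≡⟨ cong f (toℕ-fromℕ< i<n) ⟩
  f i                           ∎
  where
  open ≡-Reasoning
  B = tabulate {n = n} (f ∘ toℕ)

module _ {n : ℕ} (G : Graph n) where

  WhiteConn-closed : ∀ {S : Fin n → Set} (C : Fin n → Set) →
    (∀ {y z} → ¬ S y → C y → Adj G y z → ¬ S z → C z) →
    ∀ {w w'} → WhiteConn G S w w' → C w → C w'
  WhiteConn-closed C closed (here _) Cw = Cw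
  WhiteConn-closed C closed (step Sx xy (here Sy)) Cx = closed Sx Cx xy Sy
  WhiteConn-closed C closed (step Sx xy c@(step Sy _ _)) Cx =
    WhiteConn-closed C closed c (closed Sx Cx xy Sy)

  PSDForces-intro : ∀ {S : Fin n → Set} {u w} (C : Fin n → Set) →
    S u → ¬ S w → Adj G u w → C w →
    (∀ {y z} → ¬ S y → C y → Adj G y z → ¬ S z → C z) →
    (∀ {z} → C z → Adj G u z → z ≡ w) → PSDForces G S u w
  PSDForces-intro C Su Sw uw Cw closed only =
    Su , Sw , uw , λ w' conn uw' → only (WhiteConn-closed C closed conn Cw) uw'

  PSDForces-unique : ∀ {S : Fin n → Set} {u w o} →
    PSDForces G S u w → Adj G w o → Adj G u o → ¬ S o → o ≡ w
  PSDForces-unique (_ , Sw , _ , only) wo uo So = only _ (step Sw wo (here So)) uo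

  module _ (f : Fin n → ℕ) (f-adj : ∀ {u w} → Adj G u w → ∣ f u - f w ∣ ≤ 1) where

    adj-spread : ∀ {c t u w} → ∣ f u - c ∣ ≤ t → Adj G u w → ∣ f w - c ∣ ≤ suc t
    adj-spread {c} {u = u} {w} fu≤t uw =
      ≤-trans (∣-∣-triangle (f w) (f u) c) (+-mono-≤ (f-adj (Graph.sym G uw)) fu≤t)

  module _ (B : Subset n) where

    Blue-mono : ∀ {t s w} → t ≤ s → Blue G B t w → Blue G B s w
    Blue-mono {s = zero} z≤n b = b
    Blue-mono {s = suc s} t≤s b with m≤n⇒m<n∨m≡n t≤s
    ... | inj₁ t<1+s = inj₁ (Blue-mono (s≤s⁻¹ t<1+s) b)
    ... | inj₂ refl = b

    Blue-invariant : (Q : ℕ → Fin n → Set) →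
      (∀ {w} → w ∈ B → Q 0 w) →
      (∀ {t w} → Q t w → Q (suc t) w) →
      (∀ {t u w} → (∀ {v} → Blue G B t v → Q t v) → PSDForces G (Blue G B t) u w → Q (suc t) w) →
      ∀ t {w} → Blue G B t w → Q t w
    Blue-invariant Q init weaken force = go
      where
      go : ∀ t {w} → Blue G B t w → Q t w
      go zero b = init b
      go (suc t) (inj₁ b) = weaken (go t b)
      go (suc t) (inj₂ (_ , F)) = force (go t) F

    closedTwins-never-blue : ∀ {x y} → Adj G x y →
      (∀ {u} → Adj G u x → u ≢ y → Adj G u y) →
      (∀ {u} → Adj G u y → u ≢ x → Adj G u x) →
      ¬ x ∈ B → ¬ y ∈ B → ∀ t → ¬ Blue G B t x
    closedTwins-never-blue {x} {y} xy x⇒y y⇒x x∉B y∉B t b = proj₁ (blue-avoids t b) refl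
      where
      Avoids : ℕ → Fin n → Set
      Avoids _ w = w ≢ x × w ≢ y

      twin-not-forced : ∀ {S : Fin n → Set} {x y u} → Adj G x y →
        (∀ {u} → Adj G u x → u ≢ y → Adj G u y) → ¬ S y → u ≢ y →
        ¬ PSDForces G S u x
      twin-not-forced xy x⇒y Sy u≢y F@(_ , _ , ux , _) =
        Graph.irrefl G (subst (Adj G _) (PSDForces-unique F xy (x⇒y ux u≢y) Sy) xy)

      blue-avoids : ∀ t {w} → Blue G B t w → Avoids t w
      blue-avoids = Blue-invariant Avoids
        (λ w∈B → (λ { refl → x∉B w∈B }) , (λ { refl → y∉B w∈B }))
        (λ av → av)
        (λ IH F → let u≢x , u≢y = IH (proj₁ F) in
          (λ { refl → twin-not-forced xy x⇒y (λ b → proj₂ (IH b) refl) u≢y F }) ,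
          (λ { refl → twin-not-forced (Graph.sym G xy) y⇒x (λ b → proj₁ (IH b) refl) u≢x F }))

    Blue-spread : (f : Fin n → ℕ) (f-adj : ∀ {u w} → Adj G u w → ∣ f u - f w ∣ ≤ 1) →
      ∀ {c} → (∀ {w} → w ∈ B → f w ≡ c) → ∀ t {w} → Blue G B t w → ∣ f w - c ∣ ≤ t
    Blue-spread f f-adj {c} init = Blue-invariant (λ t w → ∣ f w - c ∣ ≤ t)
      (λ w∈B → ≤-reflexive (trans (cong (∣_- c ∣) (init w∈B)) (∣n-n∣≡0 c)))
      m≤n⇒m≤1+n
      (λ IH (Su , _ , uw , _) → adj-spread f f-adj (IH Su) uw)

∣m-n∣≤1 : ∀ {m n} → m ≤ suc n → n ≤ suc m → ∣ m - n ∣ ≤ 1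
∣m-n∣≤1 {zero} _ n≤1 = n≤1
∣m-n∣≤1 {suc m} {zero} m≤0 _ = m≤0
∣m-n∣≤1 {suc m} {suc n} m≤n n≤m = ∣m-n∣≤1 (s≤s⁻¹ m≤n) (s≤s⁻¹ n≤m)

⌈n/2⌉≤m : ∀ {n m} → n ≤ m + m → ⌈ n /2⌉ ≤ m
⌈n/2⌉≤m {m = m} n≤2m = ≤-trans (⌈n/2⌉-mono n≤2m) (≤-reflexive (sym (n≡⌈n+n/2⌉ m)))

module Lollipop (b r' : ℕ) where

  a' a m r n : ℕ
  a' = suc b
  a = suc a'
  m = suc a
  r = suc r'
  n = m + r

  G : Graph n
  G = lollipop m r

  -- Collapses the core to a' and keeps the index of every vertex from a on, so that adjacent
  -- vertices differ by at most one in level.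
  level : ℕ → ℕ
  level i = i ⊔ a'

  level-core : ∀ {i} → i < a → level i ≡ a'
  level-core i<a = m≤n⇒m⊔n≡n (s≤s⁻¹ i<a)

  level-step : ∀ {i j} → LolAdj m i j → level j ≤ suc (level i)
  level-step {i} (clique _ j<m _) = ≤-trans (⊔-lub (s≤s⁻¹ j<m) (n≤1+n a')) (s≤s (m≤n⊔m i a'))
  level-step {i} (pathR _ refl) = ⊔-lub (s≤s (m≤m⊔n i a')) (≤-trans (n≤1+n a') (s≤s (m≤n⊔m i a')))
  level-step {j = j} (pathL _ refl) = ≤-trans (⊔-mono-≤ (n≤1+n j) (≤-refl {a'})) (n≤1+n _)

  level-a+ : ∀ j → level (a + j) ≡ a + j
  level-a+ j = m≥n⇒m⊔n≡m (≤-trans (n≤1+n a') (m≤m+n a j))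

  height : Fin n → ℕ
  height w = level (toℕ w)

  height-adj : ∀ {u w} → Adj G u w → ∣ height u - height w ∣ ≤ 1
  height-adj uw = ∣m-n∣≤1 (level-step (Graph.sym G uw)) (level-step uw)

  core-nbr : ∀ {i j} → i < a → LolAdj m i j → j ≤ a
  core-nbr _ (clique _ j<m _) = s≤s⁻¹ j<m
  core-nbr i<a (pathR m≤j refl) = ⊥-elim (<-irrefl refl (≤-trans m≤j i<a))
  core-nbr i<a (pathL m≤i _) = ⊥-elim (<-irrefl refl (≤-trans m≤i (<⇒≤ i<a)))

  clique-adj : ∀ {i j} → i ≤ a → j ≤ a → i ≢ j → LolAdj m i j
  clique-adj i≤a j≤a = clique (s≤s i≤a) (s≤s j≤a)

  a<n : a < n
  a<n = s≤s (m≤m+n a r)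

  attach : Fin n
  attach = fromℕ< a<n

  toℕ-attach : toℕ attach ≡ a
  toℕ-attach = toℕ-fromℕ< a<n

  last : Fin n
  last = fromℕ< (≤-refl {n})

  toℕ-last : toℕ last ≡ a + r
  toℕ-last = toℕ-fromℕ< (≤-refl {n})

  core-attach-adj : ∀ {x} → toℕ x < a → Adj G x attach
  core-attach-adj x<a =
    clique-adj (<⇒≤ x<a) (≤-reflexive toℕ-attach) (λ e → <-irrefl (trans e toℕ-attach) x<a)

  core-vertex : ∀ {i} → i < a → Fin n
  core-vertex i<a = fromℕ< (<-trans i<a a<n)

  toℕ-core-vertex : ∀ {i} (i<a : i < a) → toℕ (core-vertex i<a) ≡ i
  toℕ-core-vertex i<a = toℕ-fromℕ< (<-trans i<a a<n)

  core-twin : ∀ {x y u} → toℕ x < a → toℕ y < a → Adj G u x → u ≢ y → Adj G u y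
  core-twin x<a y<a ux u≢y =
    clique-adj (core-nbr x<a (Graph.sym G ux)) (<⇒≤ y<a) (u≢y ∘ toℕ-injective)

  CoreExcept : Fin n → Fin n → Set
  CoreExcept x w = toℕ w < a × toℕ w ≢ toℕ x

  attach-not-core : ∀ {x} → ¬ CoreExcept x attach
  attach-not-core (a<a , _) = <-irrefl toℕ-attach a<a

  last-not-core : ∀ {x} → ¬ CoreExcept x last
  last-not-core (last<a , _) = <-irrefl refl (≤-<-trans (m≤m+n a r) (subst (_< a) toℕ-last last<a))

  -- The white vertices x and attach are adjacent to each other and to u, so u can force one
  -- of them only once the other is blue.
  core-forces : ∀ {S : Fin n → Set} {x u w} → toℕ x < a → CoreExcept x u → PSDForces G S u w →
    CoreExcept x w ⊎ (w ≡ x × ¬ ¬ S attach) ⊎ (w ≡ attach × ¬ ¬ S x)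
  core-forces {S} {x} {u} {w} x<a (u<a , u≢x) F@(_ , _ , uw , _) with toℕ w <? a | toℕ w ≟ toℕ x
  ... | yes w<a | no w≢x = inj₁ (w<a , w≢x)
  ... | yes w<a | yes w≡x = inj₂ (inj₁ (toℕ-injective w≡x , attach-blue))
    where
    attach-blue : ¬ ¬ S attach
    attach-blue attach-white = <-irrefl (trans (cong toℕ (sym attach≡w)) toℕ-attach) w<a
      where
      attach≡w : attach ≡ w
      attach≡w = PSDForces-unique G F (core-attach-adj w<a) (core-attach-adj u<a) attach-white
  ... | no w≮a | _ = inj₂ (inj₂ (w≡attach , x-blue))
    where
    w≡a : toℕ w ≡ a
    w≡a = ≤-antisym (core-nbr u<a uw) (≮⇒≥ w≮a)
    w≡attach : w ≡ attach
    w≡attach = toℕ-injective (trans w≡a (sym toℕ-attach))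
    x-blue : ¬ ¬ S x
    x-blue x-white = w≮a (subst (_< a) (cong toℕ x≡w) x<a)
      where
      x≡w : x ≡ w
      x≡w = PSDForces-unique G F
        (clique-adj (≤-reflexive w≡a) (<⇒≤ x<a) (λ w≡x → <-irrefl (trans (sym w≡x) w≡a) x<a))
        (clique-adj (<⇒≤ u<a) (<⇒≤ x<a) u≢x)
        x-white

  -- On the path a blue vertex u separates the two sides, so the white component of a white
  -- neighbour w of u stays on w's side.
  forces-up : ∀ {S : Fin n → Set} {u w} → S u → ¬ S w → a ≤ toℕ u → suc (toℕ u) ≡ toℕ w →
    PSDForces G S u w
  forces-up {S} {u} {w} Su Sw a≤u u+1≡w =
    PSDForces-intro G (λ z → toℕ w ≤ toℕ z) Su Sw (pathR m≤w u+1≡w) ≤-refl closed only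
    where
    m≤w : m ≤ toℕ w
    m≤w = subst (m ≤_) u+1≡w (s≤s a≤u)
    closed : ∀ {y z} → ¬ S y → toℕ w ≤ toℕ y → Adj G y z → ¬ S z → toℕ w ≤ toℕ z
    closed _ w≤y (clique y<m _ _) _ = ⊥-elim (<-irrefl refl (≤-trans m≤w (≤-trans w≤y (s≤s⁻¹ y<m))))
    closed _ w≤y (pathR _ y+1≡z) _ = subst (toℕ w ≤_) y+1≡z (m≤n⇒m≤1+n w≤y)
    closed {z = z} _ w≤y (pathL _ z+1≡y) Sz with toℕ w ≤? toℕ z
    ... | yes w≤z = w≤z
    ... | no w≰z = ⊥-elim (Sz (subst S (toℕ-injective u≡z) Su))
      where
      u≡z : toℕ u ≡ toℕ z
      u≡z = ≤-antisym
        (s≤s⁻¹ (≤-trans (≤-reflexive u+1≡w) (≤-trans w≤y (≤-reflexive (sym z+1≡y)))))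
        (s≤s⁻¹ (subst (suc (toℕ z) ≤_) (sym u+1≡w) (≰⇒> w≰z)))
    only : ∀ {z} → toℕ w ≤ toℕ z → Adj G u z → z ≡ w
    only w≤z (clique _ z<m _) = ⊥-elim (<-irrefl refl (≤-trans m≤w (≤-trans w≤z (s≤s⁻¹ z<m))))
    only w≤z (pathR _ u+1≡z) = toℕ-injective (trans (sym u+1≡z) u+1≡w)
    only w≤z (pathL _ z+1≡u) = ⊥-elim (<-irrefl refl
      (≤-trans (s≤s (≤-trans (n≤1+n (toℕ u)) (≤-trans (≤-reflexive u+1≡w) w≤z))) (≤-reflexive z+1≡u)))

  forces-down : ∀ {S : Fin n → Set} {u w} → S u → ¬ S w → a ≤ toℕ w → suc (toℕ w) ≡ toℕ u →
    PSDForces G S u w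
  forces-down {S} {u} {w} Su Sw a≤w w+1≡u =
    PSDForces-intro G (λ z → toℕ z ≤ toℕ w) Su Sw (pathL m≤u w+1≡u) ≤-refl closed only
    where
    m≤u : m ≤ toℕ u
    m≤u = subst (m ≤_) w+1≡u (s≤s a≤w)
    closed : ∀ {y z} → ¬ S y → toℕ y ≤ toℕ w → Adj G y z → ¬ S z → toℕ z ≤ toℕ w
    closed _ _ (clique _ z<m _) _ = ≤-trans (s≤s⁻¹ z<m) a≤w
    closed {z = z} _ y≤w (pathR _ y+1≡z) Sz with m≤n⇒m<n∨m≡n y≤w
    ... | inj₁ y<w = subst (_≤ toℕ w) y+1≡z y<w
    ... | inj₂ y≡w = ⊥-elim (Sz (subst S (toℕ-injective u≡z) Su))
      where
      u≡z : toℕ u ≡ toℕ z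
      u≡z = trans (sym w+1≡u) (trans (cong suc (sym y≡w)) y+1≡z)
    closed _ y≤w (pathL _ z+1≡y) _ = ≤-trans (n≤1+n _) (≤-trans (≤-reflexive z+1≡y) y≤w)
    only : ∀ {z} → toℕ z ≤ toℕ w → Adj G u z → z ≡ w
    only _ (clique u<m _ _) = ⊥-elim (<-irrefl refl (≤-trans m≤u (s≤s⁻¹ u<m)))
    only z≤w (pathR _ u+1≡z) = ⊥-elim (<-irrefl refl
      (≤-trans (s≤s (≤-trans (n≤1+n _) (≤-reflexive w+1≡u))) (≤-trans (≤-reflexive u+1≡z) z≤w)))
    only _ (pathL _ z+1≡u) = toℕ-injective (suc-injective (trans z+1≡u (sym w+1≡u)))

  tail-length : ∣ height last - a' ∣ ≡ suc r
  tail-length = begin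
    ∣ height last - a' ∣    ≡⟨ cong (λ i → ∣ level i - a' ∣) toℕ-last ⟩
    ∣ level (a + r) - a' ∣  ≡⟨ cong ∣_- a' ∣ (level-a+ r) ⟩
    ∣ a + r - a' ∣          ≡⟨ cong ∣_- a' ∣ (sym (+-suc a' r)) ⟩
    ∣ a' + suc r - a' ∣     ≡⟨ ∣-∣-comm (a' + suc r) a' ⟩
    ∣ a' - a' + suc r ∣     ≡⟨ ∣m-m+n∣≡n a' (suc r) ⟩
    suc r                  ∎
    where open ≡-Reasoning

  Near : Fin n → ℕ → Fin n → Set
  Near v t w = ∣ height w - height v ∣ ≤ t

  Near-adj : ∀ {v t u w} → Near v t u → Adj G u w → Near v (suc t) w
  Near-adj = adj-spread G height height-adj

  module _ (B : Subset n) where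

    core-frozen : ∀ {x} → toℕ x < a → (∀ {w} → w ∈ B → CoreExcept x w) →
      ∀ t {w} → Blue G B t w → CoreExcept x w
    core-frozen {x} x<a init = Blue-invariant G B (λ _ → CoreExcept x) init (λ core → core) preserved
      where
      preserved : ∀ {t u w} → (∀ {v} → Blue G B t v → CoreExcept x v) →
        PSDForces G (Blue G B t) u w → CoreExcept x w
      preserved IH F with core-forces x<a (IH (proj₁ F)) F
      ... | inj₁ core = core
      ... | inj₂ (inj₁ (_ , attach-blue)) = ⊥-elim (attach-blue (attach-not-core ∘ IH))
      ... | inj₂ (inj₂ (_ , x-blue)) = ⊥-elim (x-blue (λ b → proj₂ (IH b) refl))

    module _ {x v} (x<a : toℕ x < a) (init : ∀ {w} → w ∈ B → CoreExcept x w ⊎ w ≡ v) where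

      core-or-near : ∀ t {w} → Blue G B t w → CoreExcept x w ⊎ Near v t w
      core-or-near = Blue-invariant G B (λ t w → CoreExcept x w ⊎ Near v t w) start
        (map₂ m≤n⇒m≤1+n) preserved
        where
        start : ∀ {w} → w ∈ B → CoreExcept x w ⊎ Near v 0 w
        start w∈B with init w∈B
        ... | inj₁ core = inj₁ core
        ... | inj₂ refl = inj₂ (≤-reflexive (∣n-n∣≡0 (height v)))

        near-if-blue : ∀ {t z} → (∀ {w} → Blue G B t w → CoreExcept x w ⊎ Near v t w) →
          ¬ CoreExcept x z → ¬ ¬ Blue G B t z → Near v t z
        near-if-blue {t} {z} IH not-core blue with ∣ height z - height v ∣ ≤? t
        ... | yes near = near
        ... | no far = ⊥-elim (blue (λ b → [ not-core , far ] (IH b)))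

        preserved : ∀ {t u w} → (∀ {w} → Blue G B t w → CoreExcept x w ⊎ Near v t w) →
          PSDForces G (Blue G B t) u w → CoreExcept x w ⊎ Near v (suc t) w
        preserved IH F@(Su , _ , uw , _) with IH Su
        ... | inj₂ near = inj₂ (Near-adj near uw)
        ... | inj₁ core with core-forces x<a core F
        ...   | inj₁ core' = inj₁ core'
        ...   | inj₂ (inj₁ (refl , attach-blue)) = inj₂ (Near-adj
                  (near-if-blue IH attach-not-core attach-blue) (Graph.sym G (core-attach-adj x<a)))
        ...   | inj₂ (inj₂ (refl , x-blue)) = inj₂ (Near-adj
                  (near-if-blue IH (λ core → proj₂ core refl) x-blue) (core-attach-adj x<a))

      all-blue⇒1+r≤t+t : ∀ t → AllBlueAt G B t → suc r ≤ t + t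
      all-blue⇒1+r≤t+t t all with core-or-near t (all x) | core-or-near t (all last)
      ... | inj₁ (_ , x≢x) | _ = ⊥-elim (x≢x refl)
      ... | _ | inj₁ last-core = ⊥-elim (last-not-core last-core)
      ... | inj₂ near-x | inj₂ near-last = begin
        suc r                       ≡⟨ sym tail-length ⟩
        ∣ height last - a' ∣        ≡⟨ cong (∣ height last -_∣) (sym (level-core x<a)) ⟩
        ∣ height last - height x ∣  ≤⟨ ∣-∣-triangle (height last) (height v) (height x) ⟩
        ∣ height last - height v ∣ + ∣ height v - height x ∣
          ≤⟨ +-mono-≤ near-last (≤-trans (≤-reflexive (∣-∣-comm (height v) (height x))) near-x) ⟩
        t + t                       ∎
        where open ≤-Reasoning

  module _ (B : Subset n) where

    tailMember : ℕ → Bool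
    tailMember j = member B (a + j)

    coreCount tailCount : ℕ
    coreCount = count (member B) a
    tailCount = count tailMember (suc r)

    ∣B∣≡coreCount+tailCount : ∣ B ∣ ≡ coreCount + tailCount
    ∣B∣≡coreCount+tailCount = begin
      ∣ B ∣                           ≡⟨ ∣∣≡count-member B ⟩
      count (member B) n              ≡⟨ cong (count (member B)) (sym (+-suc a r)) ⟩
      count (member B) (a + suc r)    ≡⟨ count-+ (member B) a (suc r) ⟩
      coreCount + tailCount           ∎
      where open ≡-Reasoning

    white-core-vertex : ∀ {i} (i<a : i < a) → member B i ≡ false → ¬ core-vertex i<a ∈ B
    white-core-vertex i<a white x∈B
      with trans (sym (∈⇒member B x∈B)) (trans (cong (member B) (toℕ-core-vertex i<a)) white)
    ... | ()

    two-white-core⇒¬all-blue : 2 + coreCount ≤ a → ∀ t → ¬ AllBlueAt G B t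
    two-white-core⇒¬all-blue 2+c≤a t all with count+2≤⇒two-false (member B) a 2+c≤a
    ... | i , j , i<a , j<a , i≢j , white-i , white-j =
      closedTwins-never-blue G B xy (core-twin x<a y<a) (core-twin y<a x<a)
        (white-core-vertex i<a white-i) (white-core-vertex j<a white-j) t (all x)
      where
      x y : Fin n
      x = core-vertex i<a
      y = core-vertex j<a
      x<a : toℕ x < a
      x<a = subst (_< a) (sym (toℕ-core-vertex i<a)) i<a
      y<a : toℕ y < a
      y<a = subst (_< a) (sym (toℕ-core-vertex j<a)) j<a
      xy : Adj G x y
      xy = clique-adj (<⇒≤ x<a) (<⇒≤ y<a) λ e →
        i≢j (trans (sym (toℕ-core-vertex i<a)) (trans e (toℕ-core-vertex j<a)))

    blue-tail-index : ∀ {w} → w ∈ B → ¬ toℕ w < a →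
      Σ ℕ λ j → j < suc r × toℕ w ≡ a + j × member B (a + j) ≡ true
    blue-tail-index {w} w∈B w≮a =
      j , j<1+r , w≡a+j , subst (λ i → member B i ≡ true) w≡a+j (∈⇒member B w∈B)
      where
      j = toℕ w ∸ a
      w≡a+j : toℕ w ≡ a + j
      w≡a+j = sym (m+[n∸m]≡n (≮⇒≥ w≮a))
      j<1+r : j < suc r
      j<1+r = +-cancelˡ-< a j (suc r)
        (subst (_< a + suc r) w≡a+j (subst (toℕ w <_) (sym (+-suc a r)) (toℕ<n w)))

    no-blue-tail : tailCount ≡ 0 → ∀ {w} → w ∈ B → toℕ w < a
    no-blue-tail none {w} w∈B with toℕ w <? a
    ... | yes w<a = w<a
    ... | no w≮a with blue-tail-index w∈B w≮a
    ...   | j , j<1+r , _ , blue with subst (1 ≤_) none (true⇒count-pos tailMember (suc r) j<1+r blue)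
    ...     | ()

    one-blue-tail : tailCount ≡ 1 → Σ (Fin n) λ v → ∀ {w} → w ∈ B → toℕ w < a ⊎ w ≡ v
    one-blue-tail one with count-pos⇒true tailMember (suc r) (≤-reflexive (sym one))
    ... | j₀ , j₀<1+r , blue₀ = v , only-v
      where
      a+j₀<n : a + j₀ < n
      a+j₀<n = s≤s (+-monoʳ-≤ a (s≤s⁻¹ j₀<1+r))
      v = fromℕ< a+j₀<n
      only-v : ∀ {w} → w ∈ B → toℕ w < a ⊎ w ≡ v
      only-v {w} w∈B with toℕ w <? a
      ... | yes w<a = inj₁ w<a
      ... | no w≮a with blue-tail-index w∈B w≮a
      ...   | j , j<1+r , w≡a+j , blue with j ≟ j₀
      ...     | yes refl = inj₂ (toℕ-injective (trans w≡a+j (sym (toℕ-fromℕ< a+j₀<n))))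
      ...     | no j≢j₀
        with subst (2 ≤_) one (two-true⇒2≤count tailMember (suc r) j<1+r j₀<1+r j≢j₀ blue blue₀)
      ...       | s≤s ()

    some-white-core : coreCount < a → Σ (Fin n) λ x → toℕ x < a × ¬ x ∈ B
    some-white-core c<a with count<⇒false (member B) a c<a
    ... | i , i<a , white =
      core-vertex i<a , subst (_< a) (sym (toℕ-core-vertex i<a)) i<a , white-core-vertex i<a white

    core-except-white : ∀ {x w} → ¬ x ∈ B → w ∈ B → toℕ w < a → CoreExcept x w
    core-except-white x∉B w∈B w<a = w<a , λ w≡x → x∉B (subst (_∈ B) (toℕ-injective w≡x) w∈B)

    ∣B∣<a⇒¬all-blue : ∣ B ∣ < a → ∀ t → ¬ AllBlueAt G B t
    ∣B∣<a⇒¬all-blue ∣B∣<a t all with tailCount in eq | ∣B∣≡coreCount+tailCount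
    ... | zero | ∣B∣≡ with some-white-core (subst (_< a) (trans ∣B∣≡ (+-identityʳ coreCount)) ∣B∣<a)
    ...   | x , x<a , x∉B = proj₂ (core-frozen B x<a stays-core t (all x)) refl
      where
      stays-core : ∀ {w} → w ∈ B → CoreExcept x w
      stays-core w∈B = core-except-white x∉B w∈B (no-blue-tail eq w∈B)
    ∣B∣<a⇒¬all-blue ∣B∣<a t all | suc c | ∣B∣≡ = two-white-core⇒¬all-blue
      (≤-trans (s≤s (m<m+n coreCount z<s)) (subst (_< a) ∣B∣≡ ∣B∣<a)) t all

    ∣B∣≡a⇒1+r≤t+t : ∣ B ∣ ≡ a → ∀ t → AllBlueAt G B t → suc r ≤ t + t
    ∣B∣≡a⇒1+r≤t+t ∣B∣≡a t all with tailCount in eq | ∣B∣≡coreCount+tailCount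
    ... | zero | _ = ≤-trans (subst (_≤ t) tail-length spread) (m≤m+n t t)
      where
      spread : ∣ height last - a' ∣ ≤ t
      spread = Blue-spread G B height height-adj (λ w∈B → level-core (no-blue-tail eq w∈B)) t (all last)
    ... | suc zero | ∣B∣≡
      with some-white-core (subst (coreCount <_) (trans (sym ∣B∣≡) ∣B∣≡a) (m<m+n coreCount z<s))
         | one-blue-tail eq
    ...   | x , x<a , x∉B | v , only-v = all-blue⇒1+r≤t+t B x<a core-or-v t all
      where
      core-or-v : ∀ {w} → w ∈ B → CoreExcept x w ⊎ w ≡ v
      core-or-v w∈B = map₁ (core-except-white x∉B w∈B) (only-v w∈B)
    ∣B∣≡a⇒1+r≤t+t ∣B∣≡a t all | suc (suc c) | ∣B∣≡ = ⊥-elim (two-white-core⇒¬all-blue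
      (≤-trans (≤-reflexive (+-comm 2 coreCount))
        (≤-trans (+-monoʳ-≤ coreCount (s≤s (s≤s z≤n))) (≤-reflexive (trans (sym ∣B∣≡) ∣B∣≡a)))) t all)

  k : ℕ
  k = ⌊ r' /2⌋

  k≤r' : k ≤ r'
  k≤r' = ⌊n/2⌋≤n r'

  a+k<n : a + k < n
  a+k<n = s≤s (+-monoʳ-≤ a (m≤n⇒m≤1+n k≤r'))

  -- The core minus vertex 0, together with the path vertex a + k in the middle of a, ..., a + r.
  inB₀ : ℕ → Bool
  inB₀ zero = false
  inB₀ (suc i) = (suc i <ᵇ a) ∨ (suc i ≡ᵇ a + k)

  B₀ : Subset n
  B₀ = tabulate (inB₀ ∘ toℕ)

  x₀ v₀ : Fin n
  x₀ = fromℕ< z<s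
  v₀ = fromℕ< a+k<n

  toℕ-v₀ : toℕ v₀ ≡ a + k
  toℕ-v₀ = toℕ-fromℕ< a+k<n

  x₀<a : toℕ x₀ < a
  x₀<a = z<s

  inB₀-core : ∀ i → i < a' → inB₀ (suc i) ≡ true
  inB₀-core i i<a' rewrite Equivalence.to T-≡ (<⇒<ᵇ (s<s i<a')) = refl

  inB₀-v₀ : inB₀ (a + k) ≡ true
  inB₀-v₀ rewrite Equivalence.to T-≡ (≡⇒≡ᵇ (a + k) (a + k) refl) = ∨-zeroʳ _

  inB₀-tail : ∀ j → inB₀ (a + j) ≡ (j ≡ᵇ k)
  inB₀-tail j = cong₂ _∨_ (m+n<ᵇm a' j) (m+n≡ᵇm+o a' j k)
    where
    m+n<ᵇm : ∀ m n → (m + n <ᵇ m) ≡ false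
    m+n<ᵇm zero n = refl
    m+n<ᵇm (suc m) n = m+n<ᵇm m n
    m+n≡ᵇm+o : ∀ m n o → (m + n ≡ᵇ m + o) ≡ (n ≡ᵇ o)
    m+n≡ᵇm+o zero n o = refl
    m+n≡ᵇm+o (suc m) n o = m+n≡ᵇm+o m n o

  member-B₀ : ∀ {i} → i < n → member B₀ i ≡ inB₀ i
  member-B₀ = member-tabulate inB₀

  ∈B₀ : ∀ {w} → inB₀ (toℕ w) ≡ true → w ∈ B₀
  ∈B₀ {w} inB = member⇒∈ B₀ (trans (member-B₀ (toℕ<n w)) inB)

  a+k∈B₀ : ∀ {w} → toℕ w ≡ a + k → w ∈ B₀
  a+k∈B₀ w≡a+k = ∈B₀ (trans (cong inB₀ w≡a+k) inB₀-v₀)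

  B₀-shape : ∀ {w} → w ∈ B₀ → CoreExcept x₀ w ⊎ w ≡ v₀
  B₀-shape {w} w∈B₀ = shape (toℕ w) refl (trans (sym (member-B₀ (toℕ<n w))) (∈⇒member B₀ w∈B₀))
    where
    shape : ∀ i → toℕ w ≡ i → inB₀ i ≡ true → CoreExcept x₀ w ⊎ w ≡ v₀
    shape (suc i) w≡i inB with suc i <ᵇ a in lt
    ... | true = inj₁ (subst (_< a) (sym w≡i) (<ᵇ⇒< _ _ (Equivalence.from T-≡ lt)) ,
                       λ w≡0 → 0≢1+n (trans (sym w≡0) w≡i))
    ... | false = inj₂ (toℕ-injective
                    (trans w≡i (trans (≡ᵇ⇒≡ _ _ (Equivalence.from T-≡ inB)) (sym toℕ-v₀))))

  ∣B₀∣≡a : ∣ B₀ ∣ ≡ a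
  ∣B₀∣≡a = begin
    ∣ B₀ ∣                                               ≡⟨ ∣B∣≡coreCount+tailCount B₀ ⟩
    count (member B₀) a + count (tailMember B₀) (suc r)  ≡⟨ cong₂ _+_ (count-cong a core) (count-cong (suc r) tail) ⟩
    count inB₀ a + count (_≡ᵇ k) (suc r)                 ≡⟨ cong₂ _+_ (count-all a' inB₀-core) (count-≡ᵇ (suc r) k<1+r) ⟩
    a' + 1                                               ≡⟨ +-comm a' 1 ⟩
    a                                                    ∎
    where
    open ≡-Reasoning
    core : ∀ i → i < a → member B₀ i ≡ inB₀ i
    core i i<a = member-B₀ (<-trans i<a a<n)
    tail : ∀ j → j < suc r → member B₀ (a + j) ≡ (j ≡ᵇ k)
    tail j j<1+r = trans (member-B₀ (s≤s (+-monoʳ-≤ a (s≤s⁻¹ j<1+r)))) (inB₀-tail j)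
    k<1+r : k < suc r
    k<1+r = s≤s (m≤n⇒m≤1+n k≤r')

  tail-blue⇒∣j-k∣≤t : ∀ {t w j} → toℕ w ≡ a + j → Blue G B₀ t w → ∣ j - k ∣ ≤ t
  tail-blue⇒∣j-k∣≤t {t} {w} {j} w≡a+j b with core-or-near B₀ x₀<a B₀-shape t b
  ... | inj₁ (w<a , _) = ⊥-elim (<-irrefl refl (≤-<-trans (m≤m+n a j) (subst (_< a) w≡a+j w<a)))
  ... | inj₂ near = subst (_≤ t) distance near
    where
    distance : ∣ height w - height v₀ ∣ ≡ ∣ j - k ∣
    distance = begin
      ∣ height w - height v₀ ∣            ≡⟨ cong₂ (λ i i' → ∣ level i - level i' ∣) w≡a+j toℕ-v₀ ⟩
      ∣ level (a + j) - level (a + k) ∣   ≡⟨ cong₂ ∣_-_∣ (level-a+ j) (level-a+ k) ⟩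
      ∣ a + j - a + k ∣                   ≡⟨ ∣m+n-m+o∣≡∣n-o∣ a j k ⟩
      ∣ j - k ∣                           ∎
      where open ≡-Reasoning

  x₀-blue⇒1+k≤t : ∀ {t} → Blue G B₀ t x₀ → suc k ≤ t
  x₀-blue⇒1+k≤t {t} b with core-or-near B₀ x₀<a B₀-shape t b
  ... | inj₁ (_ , x₀≢x₀) = ⊥-elim (x₀≢x₀ refl)
  ... | inj₂ near = subst (_≤ t) distance near
    where
    distance : ∣ height x₀ - height v₀ ∣ ≡ suc k
    distance = begin
      ∣ a' - level (toℕ v₀) ∣  ≡⟨ cong (λ i → ∣ a' - level i ∣) toℕ-v₀ ⟩
      ∣ a' - level (a + k) ∣   ≡⟨ cong ∣ a' -_∣ (trans (level-a+ k) (sym (+-suc a' k))) ⟩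
      ∣ a' - a' + suc k ∣      ≡⟨ ∣m-m+n∣≡n a' (suc k) ⟩
      suc k                   ∎
      where open ≡-Reasoning

  tail-below : ∀ d e {w} → d + e ≡ k → toℕ w ≡ a + e → Blue G B₀ d w
  tail-below zero e e≡k w≡a+e = a+k∈B₀ (trans w≡a+e (cong (a +_) e≡k))
  tail-below (suc d) e {w} 1+d+e≡k w≡a+e =
    inj₂ (u , forces-down u-blue white a≤w w+1≡u)
    where
    a+1+e<n : a + suc e < n
    a+1+e<n = ≤-<-trans (+-monoʳ-≤ a (≤-trans (s≤s (m≤n+m e d)) (≤-reflexive 1+d+e≡k))) a+k<n
    u = fromℕ< a+1+e<n
    u-blue : Blue G B₀ d u
    u-blue = tail-below d (suc e) (trans (+-suc d e) 1+d+e≡k) (toℕ-fromℕ< a+1+e<n)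
    a≤w : a ≤ toℕ w
    a≤w = subst (a ≤_) (sym w≡a+e) (m≤m+n a e)
    w+1≡u : suc (toℕ w) ≡ toℕ u
    w+1≡u = trans (cong suc w≡a+e) (trans (sym (+-suc a e)) (sym (toℕ-fromℕ< a+1+e<n)))
    white : ¬ Blue G B₀ d w
    white b = <-irrefl refl (subst (_≤ d) gap (tail-blue⇒∣j-k∣≤t w≡a+e b))
      where
      gap : ∣ e - k ∣ ≡ suc d
      gap = trans (cong ∣ e -_∣ (trans (sym 1+d+e≡k) (+-comm (suc d) e))) (∣m-m+n∣≡n e (suc d))

  tail-above : ∀ d {w} → toℕ w ≡ a + (k + d) → Blue G B₀ d w
  tail-above zero w≡a+k+0 = a+k∈B₀ (trans w≡a+k+0 (cong (a +_) (+-identityʳ k)))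
  tail-above (suc d) {w} w≡a+k+1+d =
    inj₂ (u , forces-up (tail-above d (toℕ-fromℕ< a+k+d<n)) white a≤u u+1≡w)
    where
    a+k+d<n : a + (k + d) < n
    a+k+d<n = ≤-<-trans (+-monoʳ-≤ a (+-monoʳ-≤ k (n≤1+n d))) (subst (_< n) w≡a+k+1+d (toℕ<n w))
    u = fromℕ< a+k+d<n
    a≤u : a ≤ toℕ u
    a≤u = subst (a ≤_) (sym (toℕ-fromℕ< a+k+d<n)) (m≤m+n a (k + d))
    u+1≡w : suc (toℕ u) ≡ toℕ w
    u+1≡w = trans (cong suc (toℕ-fromℕ< a+k+d<n))
                  (trans (sym (+-suc a (k + d))) (trans (cong (a +_) (sym (+-suc k d))) (sym w≡a+k+1+d)))
    white : ¬ Blue G B₀ d w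
    white b = <-irrefl refl (subst (_≤ d) gap (tail-blue⇒∣j-k∣≤t w≡a+k+1+d b))
      where
      gap : ∣ k + suc d - k ∣ ≡ suc d
      gap = trans (∣-∣-comm (k + suc d) k) (∣m-m+n∣≡n k (suc d))

  core-in-B₀ : ∀ {w} → toℕ w < a → toℕ w ≢ 0 → w ∈ B₀
  core-in-B₀ {w} w<a w≢0 = ∈B₀ (inB₀-core' (toℕ w) w<a w≢0)
    where
    inB₀-core' : ∀ i → i < a → i ≢ 0 → inB₀ i ≡ true
    inB₀-core' zero _ 0≢0 = ⊥-elim (0≢0 refl)
    inB₀-core' (suc i) i<a _ = inB₀-core i (s≤s⁻¹ i<a)

  clique-blue-at-k : ∀ {w} → toℕ w ≤ a → toℕ w ≢ 0 → Blue G B₀ k w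
  clique-blue-at-k w≤a w≢0 with m≤n⇒m<n∨m≡n w≤a
  ... | inj₁ w<a = Blue-mono G B₀ z≤n (core-in-B₀ w<a w≢0)
  ... | inj₂ w≡a = tail-below k 0 (+-identityʳ k) (trans w≡a (sym (+-identityʳ a)))

  -- At time k every clique vertex other than 0 is blue, so vertex 1 forces 0.
  x₀-blue : Blue G B₀ (suc k) x₀
  x₀-blue = inj₂ (u₁ , PSDForces-intro G (_≡ x₀) (clique-blue-at-k 1≤a λ ()) x₀-white u₁x₀ refl closed
                         λ z≡x₀ _ → z≡x₀)
    where
    1≤a : 1 ≤ a
    1≤a = s≤s z≤n
    u₁ : Fin n
    u₁ = fromℕ< (s≤s (s≤s z≤n))
    u₁x₀ : Adj G u₁ x₀
    u₁x₀ = clique-adj 1≤a z≤n λ ()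
    x₀-white : ¬ Blue G B₀ k x₀
    x₀-white b = <-irrefl refl (x₀-blue⇒1+k≤t b)
    closed : ∀ {y z} → ¬ Blue G B₀ k y → y ≡ x₀ → Adj G y z → ¬ Blue G B₀ k z → z ≡ x₀
    closed {z = z} _ refl x₀z z-white = ⊥-elim (z-white (clique-blue-at-k (core-nbr x₀<a x₀z) z≢0))
      where
      z≢0 : toℕ z ≢ 0
      z≢0 z≡0 = Graph.irrefl G (subst (Adj G x₀) (toℕ-injective z≡0) x₀z)

  P : ℕ
  P = ⌈ suc r /2⌉

  k<P : k < P
  k<P = s≤s (⌊n/2⌋≤⌈n/2⌉ r')

  all-blue₀ : AllBlueAt G B₀ P
  all-blue₀ w with toℕ w <? a
  ... | yes w<a with toℕ w ≟ 0
  ...   | yes w≡0 = Blue-mono G B₀ k<P (subst (Blue G B₀ (suc k)) (toℕ-injective (sym w≡0)) x₀-blue)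
  ...   | no w≢0 = Blue-mono G B₀ z≤n (core-in-B₀ w<a w≢0)
  all-blue₀ w | no w≮a with toℕ w ∸ a ≤? k
  ... | yes j≤k =
    Blue-mono G B₀ (≤-trans (m∸n≤m k j) (<⇒≤ k<P)) (tail-below (k ∸ j) j (m∸n+n≡m j≤k) w≡a+j)
    where
    j = toℕ w ∸ a
    w≡a+j : toℕ w ≡ a + j
    w≡a+j = sym (m+[n∸m]≡n (≮⇒≥ w≮a))
  ... | no j≰k = Blue-mono G B₀ d≤P (tail-above d w≡a+k+d)
    where
    j = toℕ w ∸ a
    d = j ∸ k
    w≡a+k+d : toℕ w ≡ a + (k + d)
    w≡a+k+d = trans (sym (m+[n∸m]≡n (≮⇒≥ w≮a))) (cong (a +_) (sym (m+[n∸m]≡n (<⇒≤ (≰⇒> j≰k)))))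
    d≤P : d ≤ P
    d≤P = +-cancelˡ-≤ k d P (+-cancelˡ-≤ a (k + d) (k + P) (s≤s⁻¹ (begin-strict
      a + (k + d)                   ≡⟨ sym w≡a+k+d ⟩
      toℕ w                         <⟨ toℕ<n w ⟩
      suc (a + r)                   ≡⟨ cong (λ i → suc (a + suc i)) (sym (⌊n/2⌋+⌈n/2⌉≡n r')) ⟩
      suc (a + suc (k + ⌈ r' /2⌉))  ≡⟨ cong (λ i → suc (a + i)) (sym (+-suc k ⌈ r' /2⌉)) ⟩
      suc (a + (k + P))             ∎)))
      where open ≤-Reasoning

  Zplus-lollipop : IsZplus G a
  Zplus-lollipop = (B₀ , (P , all-blue₀) , ∣B₀∣≡a) , a≤∣B∣
    where
    a≤∣B∣ : ∀ B → IsPSDForcingSet G B → a ≤ ∣ B ∣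
    a≤∣B∣ B (t , all) with a ≤? ∣ B ∣
    ... | yes a≤∣B∣ = a≤∣B∣
    ... | no a≰∣B∣ = ⊥-elim (∣B∣<a⇒¬all-blue B (≰⇒> a≰∣B∣) t all)

  ptplus-lollipop : IsPtplus G a P
  ptplus-lollipop =
    (B₀ , ∣B₀∣≡a , all-blue₀ , P≤ B₀ ∣B₀∣≡a) , λ B t ∣B∣≡a (all , _) → P≤ B ∣B∣≡a t all
    where
    P≤ : ∀ B → ∣ B ∣ ≡ a → ∀ t → AllBlueAt G B t → P ≤ t
    P≤ B ∣B∣≡a t all = ⌈n/2⌉≤m (∣B∣≡a⇒1+r≤t+t B ∣B∣≡a t all)

  n∸a≡1+r : n ∸ a ≡ suc r
  n∸a≡1+r = trans (cong (_∸ a) (sym (+-suc a r))) (m+n∸m≡n a (suc r))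

proposition4p6 : (m r : ℕ) → 3 ≤ m → 1 ≤ r →
    Σ ℕ λ z → IsZplus (lollipop m r) z ×
      Σ ℕ λ p → IsPtplus (lollipop m r) z p × p ≡ ⌈ (m + r ∸ z) /2⌉
proposition4p6 (suc (suc (suc b))) (suc r') (s≤s (s≤s (s≤s z≤n))) (s≤s z≤n) =
  a , Zplus-lollipop , P , ptplus-lollipop , cong ⌈_/2⌉ (sym n∸a≡1+r)
  where open Lollipop b r'
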